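{- Let $1\le a<n$ be integers with $\gcd(a,n)=1$, and let $b$ be the integer with $1\le b<n$ and $ab\equiv 1 \pmod n$. Then the parallelograms $P_{a,n}$ and $P_{b,n}$ are unimodularly equivalent, i.e. there is a unimodular linear transformation $L:\mathbb{R}^2\to\mathbb{R}^2$ with $L(P_{a,n})=P_{b,n}$. Consequently $V(a,n)=V(b,n)$.
   Context: For integers $1\le a<n$ with $\gcd(a,n)=1$, $P_{a,n}=\{t_1(1,0)+t_2(a,n) : 0\le t_1,t_2\le 1\}$. A linear map is unimodular if it is represented by a $2\times2$ integer matrix of determinant $\pm1$. A lattice point $(u_1,u_2)$ is visible if $\gcd(u_1,u_2)=1$, and $V(a,n)$ is the number of visible lattice points in the interior of $P_{a,n}$.
   Formalization: The parallelograms $P_{a,n}$ and $P_{b,n}$ consist of points with rational coordinates, and the unimodular map L acts on ℚ² instead of ℝ². -}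

module Defs where

open import Data.Bool using (Bool; _∧_)
open import Data.Nat as ℕ using (ℕ; suc; _<ᵇ_; _≡ᵇ_)
open import Data.Nat.GCD using (gcd)
open import Data.Integer as ℤ using (ℤ; +_; -[1+_])
open import Data.Rational as ℚ using (ℚ; _/_; 0ℚ; 1ℚ)
open import Data.List using (List; length; filterᵇ; cartesianProduct; upTo)
open import Data.Product using (Σ; _×_; _,_; ∃)
open import Data.Sum using (_⊎_)
open import Relation.Binary.PropositionalEquality using (_≡_)

ℚ² : Set
ℚ² = ℚ × ℚ

ι : ℤ → ℚ
ι z = z / 1

record Mat₂ : Set where
  constructor mat
  field
    m11 m12 m21 m22 : ℤ

det : Mat₂ → ℤ
det (mat p q r s) = (p ℤ.* s) ℤ.- (q ℤ.* r)

Unimodular : Mat₂ → Set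
Unimodular M = (det M ≡ + 1) ⊎ (det M ≡ -[1+ 0 ])

act : Mat₂ → ℚ² → ℚ²
act (mat p q r s) (x , y) =
  ((ι p ℚ.* x) ℚ.+ (ι q ℚ.* y)) , ((ι r ℚ.* x) ℚ.+ (ι s ℚ.* y))

InP : ℕ → ℕ → ℚ² → Set
InP a n (x , y) =
  Σ ℚ λ t₁ → Σ ℚ λ t₂ →
    (0ℚ ℚ.≤ t₁) × (t₁ ℚ.≤ 1ℚ) × (0ℚ ℚ.≤ t₂) × (t₂ ℚ.≤ 1ℚ) ×
    (x ≡ t₁ ℚ.+ (t₂ ℚ.* ι (+ a))) × (y ≡ t₂ ℚ.* ι (+ n))

MapsOnto : Mat₂ → (ℚ² → Set) → (ℚ² → Set) → Set
MapsOnto L P P' =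
  (∀ p → P p → P' (act L p)) × (∀ q → P' q → ∃ λ p → P p × (act L p ≡ q))

-- A lattice point (u₁,u₂) equals
-- t₁ (1,0) + t₂ (a,n) exactly for t₂ = u₂/n, t₁ = (n u₁ - a u₂)/n, so it lies
-- in the interior (0 < t₁,t₂ < 1) iff 0 < u₂ < n and a u₂ < n u₁ < a u₂ + n.
-- Such points satisfy 1 ≤ u₁ ≤ a < n and 1 ≤ u₂ < n, so all of them lie in
-- the box {0..n} × {0..n} enumerated below.
interiorᵇ : ℕ → ℕ → ℕ × ℕ → Bool
interiorᵇ a n (u₁ , u₂) =
  (0 <ᵇ u₂) ∧ (u₂ <ᵇ n) ∧ (a ℕ.* u₂ <ᵇ n ℕ.* u₁) ∧ (n ℕ.* u₁ <ᵇ a ℕ.* u₂ ℕ.+ n)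

visibleᵇ : ℕ × ℕ → Bool
visibleᵇ (u₁ , u₂) = gcd u₁ u₂ ≡ᵇ 1

V : ℕ → ℕ → ℕ
V a n = length (filterᵇ (λ u → interiorᵇ a n u ∧ visibleᵇ u)
                        (cartesianProduct (upTo (suc n)) (upTo (suc n))))

{-# OPTIONS --safe #-}
-- With a b = 1 + k n, the integer matrix L = [[b, -k], [n, -a]] sends (1,0) to (b,n) and (a,n)
-- to (1,0): it exchanges the edge vectors of P_{a,n} and P_{b,n}, so L(P_{a,n}) = P_{b,n}, and
-- det L = -1.  Its inverse [[a, -k], [n, -b]] is the same matrix with a and b exchanged.  On
-- lattice points L keeps interior points interior, and since L and its inverse are integral it
-- preserves the gcd of the coordinates; hence V(a,n) ≤ V(b,n), and V(b,n) ≤ V(a,n) by symmetry.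
module Submission where

open import Defs
open import Data.Bool using (Bool; T; _∧_)
open import Data.Bool.Properties using (T-∧)
open import Data.Nat using (ℕ; zero; suc; _+_; _*_; _∸_; _<_; _≤_; z≤n; s≤s; NonZero)
open import Data.Nat.Properties
open import Data.Nat.Coprimality using (gcd≡1⇒coprime)
open import Data.Nat.Divisibility using (_∣_; divides-refl; divides; ∣n⇒∣m*n; ∣1⇒≡1)
open import Data.Nat.GCD using (gcd; gcd[m,n]∣m; gcd[m,n]∣n; gcd-greatest; gcd-zeroʳ)
open import Data.Nat.Tactic.RingSolver using (solve)
open import Data.Integer as ℤ using (ℤ; +_; 0ℤ; 1ℤ; -1ℤ)
import Data.Integer.Properties as ℤ
import Data.Integer.Tactic.RingSolver as ℤ
open import Data.Rational as ℚ using (ℚ; mkℚ; _/_; 0ℚ; 1ℚ)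
import Data.Rational.Properties as ℚ
open import Data.Rational.Solver using (module +-*-Solver)
open import Data.List using (List; []; _∷_; length; filterᵇ; cartesianProduct; upTo)
open import Data.List.Properties using (length-removeAt′)
open import Data.List.Membership.Propositional using (_∈_; _─_)
open import Data.List.Membership.Propositional.Properties
  using (∈-filter⁻; ∈-filter⁺; ∈-cartesianProduct⁺; ∈-upTo⁺)
open import Data.List.Relation.Unary.Any using (here; there; index)
import Data.List.Relation.Unary.All as All
open import Data.List.Relation.Unary.AllPairs using (_∷_)
open import Data.List.Relation.Unary.Unique.Propositional using (Unique)
import Data.List.Relation.Unary.Unique.Propositional.Properties as Unique
open import Data.Product using (Σ; ∃; _×_; _,_; proj₁; proj₂)
open import Data.Sum using (inj₂)
open import Function using (_∘_)
open import Function.Bundles using (module Equivalence)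
open import Relation.Binary.PropositionalEquality
open import Relation.Nullary using (contradiction)
open import Relation.Nullary.Decidable using (T?)

open Equivalence using (to; from)

module _ {A : Set} where

  ∈-─⁺ : ∀ {x z : A} {ys} (x∈ys : x ∈ ys) → z ∈ ys → z ≢ x → z ∈ ys ─ x∈ys
  ∈-─⁺ (here refl) (here refl)  z≢x = contradiction refl z≢x
  ∈-─⁺ (here _)    (there z∈ys) _   = z∈ys
  ∈-─⁺ (there _)   (here z≡y)   _   = here z≡y
  ∈-─⁺ (there x∈ys) (there z∈ys) z≢x = there (∈-─⁺ x∈ys z∈ys z≢x)

module _ {A B : Set} where

  length-≤-injectiveOn : ∀ (f : A → B) {xs ys} → Unique xs →
    (∀ {x} → x ∈ xs → f x ∈ ys) →
    (∀ {x y} → x ∈ xs → y ∈ xs → f x ≡ f y → x ≡ y) →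
    length xs ≤ length ys
  length-≤-injectiveOn f {[]} _ _ _ = z≤n
  length-≤-injectiveOn f {x ∷ xs} {ys} (x∉xs ∷ xs!) maps inj = begin
    suc (length xs)           ≤⟨ s≤s (length-≤-injectiveOn f xs! maps′ inj′) ⟩
    suc (length (ys ─ fx∈ys)) ≡⟨ length-removeAt′ ys (index fx∈ys) ⟨
    length ys                 ∎
    where
    open ≤-Reasoning
    fx∈ys = maps (here refl)
    maps′ : ∀ {z} → z ∈ xs → f z ∈ ys ─ fx∈ys
    maps′ z∈xs = ∈-─⁺ fx∈ys (maps (there z∈xs))
      (λ fz≡fx → All.lookup x∉xs z∈xs (sym (inj (there z∈xs) (here refl) fz≡fx)))
    inj′ : ∀ {x y} → x ∈ xs → y ∈ xs → f x ≡ f y → x ≡ y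
    inj′ x∈xs y∈xs = inj (there x∈xs) (there y∈xs)

-- ι z is already in lowest terms, so after this rewrite ℚ-arithmetic on it computes.
ι≡mkℚ : ∀ z → ι z ≡ mkℚ z 0 (gcd≡1⇒coprime (gcd-zeroʳ ℤ.∣ z ∣))
ι≡mkℚ z = ℚ.↥p/↧p≡p _

ι-homo-* : ∀ x y → ι (x ℤ.* y) ≡ ι x ℚ.* ι y
ι-homo-* x y rewrite ι≡mkℚ x | ι≡mkℚ y = refl

ι-homo-+ : ∀ x y → ι (x ℤ.+ y) ≡ ι x ℚ.+ ι y
ι-homo-+ x y rewrite ι≡mkℚ x | ι≡mkℚ y =
  cong₂ (λ p q → (p ℤ.+ q) / 1) (sym (ℤ.*-identityʳ x)) (sym (ℤ.*-identityʳ y))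

ι-combination : ∀ p x q y → ι (p ℤ.* x ℤ.+ q ℤ.* y) ≡ ι p ℚ.* ι x ℚ.+ ι q ℚ.* ι y
ι-combination p x q y rewrite ι-homo-+ (p ℤ.* x) (q ℤ.* y) | ι-homo-* p x | ι-homo-* q y = refl

na+[-a]n≡0 : ∀ n a → n ℤ.* a ℤ.+ ℤ.- a ℤ.* n ≡ 0ℤ
na+[-a]n≡0 = ℤ.solve-∀

swapMat : ℤ → ℤ → ℤ → ℤ → Mat₂
swapMat a b k n = mat b (ℤ.- k) n (ℤ.- a)

module _ (a b k n : ℤ) (ba≡1+kn : b ℤ.* a ≡ 1ℤ ℤ.+ k ℤ.* n) where

  ba+[-k]n≡1 : b ℤ.* a ℤ.+ ℤ.- k ℤ.* n ≡ 1ℤ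
  ba+[-k]n≡1 = begin
    b ℤ.* a ℤ.+ ℤ.- k ℤ.* n          ≡⟨ cong (ℤ._+ ℤ.- k ℤ.* n) ba≡1+kn ⟩
    1ℤ ℤ.+ k ℤ.* n ℤ.+ ℤ.- k ℤ.* n   ≡⟨ ℤ.solve (k ∷ n ∷ []) ⟩
    1ℤ                               ∎
    where open ≡-Reasoning

  det-swapMat : det (swapMat a b k n) ≡ -1ℤ
  det-swapMat = begin
    b ℤ.* ℤ.- a ℤ.- ℤ.- k ℤ.* n      ≡⟨ ℤ.solve (a ∷ b ∷ k ∷ n ∷ []) ⟩
    ℤ.- (b ℤ.* a ℤ.+ ℤ.- k ℤ.* n)    ≡⟨ cong ℤ.-_ ba+[-k]n≡1 ⟩
    -1ℤ                              ∎
    where open ≡-Reasoning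

  swapMat-unimodular : Unimodular (swapMat a b k n)
  swapMat-unimodular = inj₂ det-swapMat

  act-swapMat : ∀ t₁ t₂ →
    act (swapMat a b k n) (t₁ ℚ.+ t₂ ℚ.* ι a , t₂ ℚ.* ι n) ≡ (t₂ ℚ.+ t₁ ℚ.* ι b , t₁ ℚ.* ι n)
  act-swapMat t₁ t₂ = cong₂ _,_ first second
    where
    open +-*-Solver using (_:+_; _:*_; _:=_; con) renaming (solve to solveℚ)
    open ≡-Reasoning
    A = ι a ; B = ι b ; K = ι (ℤ.- k) ; N = ι n ; A′ = ι (ℤ.- a)
    BA+KN≡1 : B ℚ.* A ℚ.+ K ℚ.* N ≡ 1ℚ
    BA+KN≡1 = trans (sym (ι-combination b a (ℤ.- k) n)) (cong ι ba+[-k]n≡1)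
    NA+A′N≡0 : N ℚ.* A ℚ.+ A′ ℚ.* N ≡ 0ℚ
    NA+A′N≡0 = trans (sym (ι-combination n a (ℤ.- a) n)) (cong ι (na+[-a]n≡0 n a))
    first : B ℚ.* (t₁ ℚ.+ t₂ ℚ.* A) ℚ.+ K ℚ.* (t₂ ℚ.* N) ≡ t₂ ℚ.+ t₁ ℚ.* B
    first = begin
      B ℚ.* (t₁ ℚ.+ t₂ ℚ.* A) ℚ.+ K ℚ.* (t₂ ℚ.* N)
        ≡⟨ solveℚ 6 (λ b t₁ t₂ a k n → b :* (t₁ :+ t₂ :* a) :+ k :* (t₂ :* n)
                                      := t₁ :* b :+ t₂ :* (b :* a :+ k :* n)) refl B t₁ t₂ A K N ⟩
      t₁ ℚ.* B ℚ.+ t₂ ℚ.* (B ℚ.* A ℚ.+ K ℚ.* N) ≡⟨ cong (λ x → t₁ ℚ.* B ℚ.+ t₂ ℚ.* x) BA+KN≡1 ⟩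
      t₁ ℚ.* B ℚ.+ t₂ ℚ.* 1ℚ
        ≡⟨ solveℚ 3 (λ t₁ t₂ b → t₁ :* b :+ t₂ :* con 1ℚ := t₂ :+ t₁ :* b) refl t₁ t₂ B ⟩
      t₂ ℚ.+ t₁ ℚ.* B ∎
    second : N ℚ.* (t₁ ℚ.+ t₂ ℚ.* A) ℚ.+ A′ ℚ.* (t₂ ℚ.* N) ≡ t₁ ℚ.* N
    second = begin
      N ℚ.* (t₁ ℚ.+ t₂ ℚ.* A) ℚ.+ A′ ℚ.* (t₂ ℚ.* N)
        ≡⟨ solveℚ 5 (λ n t₁ t₂ a a′ → n :* (t₁ :+ t₂ :* a) :+ a′ :* (t₂ :* n)
                                      := t₁ :* n :+ t₂ :* (n :* a :+ a′ :* n)) refl N t₁ t₂ A A′ ⟩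
      t₁ ℚ.* N ℚ.+ t₂ ℚ.* (N ℚ.* A ℚ.+ A′ ℚ.* N) ≡⟨ cong (λ x → t₁ ℚ.* N ℚ.+ t₂ ℚ.* x) NA+A′N≡0 ⟩
      t₁ ℚ.* N ℚ.+ t₂ ℚ.* 0ℚ
        ≡⟨ solveℚ 2 (λ x t₂ → x :+ t₂ :* con 0ℚ := x) refl (t₁ ℚ.* N) t₂ ⟩
      t₁ ℚ.* N ∎

swapMat-mapsOnto : ∀ a b k n → + b ℤ.* + a ≡ 1ℤ ℤ.+ + k ℤ.* + n →
  MapsOnto (swapMat (+ a) (+ b) (+ k) (+ n)) (InP a n) (InP b n)
swapMat-mapsOnto a b k n ba≡1+kn = image⊆ , ⊆image
  where
  L = swapMat (+ a) (+ b) (+ k) (+ n)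
  L-swaps : ∀ t₁ t₂ → act L (t₁ ℚ.+ t₂ ℚ.* ι (+ a) , t₂ ℚ.* ι (+ n))
                     ≡ (t₂ ℚ.+ t₁ ℚ.* ι (+ b) , t₁ ℚ.* ι (+ n))
  L-swaps = act-swapMat (+ a) (+ b) (+ k) (+ n) ba≡1+kn
  image⊆ : ∀ p → InP a n p → InP b n (act L p)
  image⊆ _ (t₁ , t₂ , 0≤t₁ , t₁≤1 , 0≤t₂ , t₂≤1 , refl , refl) =
    t₂ , t₁ , 0≤t₂ , t₂≤1 , 0≤t₁ , t₁≤1 , cong proj₁ (L-swaps t₁ t₂) , cong proj₂ (L-swaps t₁ t₂)
  ⊆image : ∀ q → InP b n q → ∃ λ p → InP a n p × act L p ≡ q
  ⊆image _ (s₁ , s₂ , 0≤s₁ , s₁≤1 , 0≤s₂ , s₂≤1 , refl , refl) =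
    _ , (s₂ , s₁ , 0≤s₂ , s₂≤1 , 0≤s₁ , s₁≤1 , refl , refl) , L-swaps s₂ s₁

∣m∣n⇒∣m∸n : ∀ {d m n} → d ∣ m → d ∣ n → d ∣ m ∸ n
∣m∣n⇒∣m∸n {d} (divides-refl p) (divides-refl q) = divides (p ∸ q) (sym (*-distribʳ-∸ d p q))

_∣²_ : ℕ → ℕ × ℕ → Set
d ∣² (u₁ , u₂) = d ∣ u₁ × d ∣ u₂

-- swapMat acting on ℕ²: the subtractions do not truncate at points of P_{a,n}.
swapℕ² : ℕ → ℕ → ℕ → ℕ → ℕ × ℕ → ℕ × ℕ
swapℕ² a b k n (u₁ , u₂) = b * u₁ ∸ k * u₂ , n * u₁ ∸ a * u₂

∣²-swapℕ² : ∀ a b k n {d} u → d ∣² u → d ∣² swapℕ² a b k n u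
∣²-swapℕ² a b k n _ (d∣u₁ , d∣u₂) =
  ∣m∣n⇒∣m∸n (∣n⇒∣m*n b d∣u₁) (∣n⇒∣m*n k d∣u₂) , ∣m∣n⇒∣m∸n (∣n⇒∣m*n n d∣u₁) (∣n⇒∣m*n a d∣u₂)

-- For (s , r) = swapℕ² a b k n (u₁ , u₂) this says n s - b r = u₂, the second row of the
-- inverse matrix swapMat b a k n, with n s expanded so that no subtraction occurs.
n*[b*u₁]≡n*[k*u₂]+[b*r+u₂] : ∀ a b k n u₁ u₂ r → b * a ≡ 1 + k * n → n * u₁ ≡ a * u₂ + r →
  n * (b * u₁) ≡ n * (k * u₂) + (b * r + u₂)
n*[b*u₁]≡n*[k*u₂]+[b*r+u₂] a b k n u₁ u₂ r ba≡1+kn nu₁≡au₂+r = begin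
  n * (b * u₁)              ≡⟨ solve (n ∷ b ∷ u₁ ∷ []) ⟩
  b * (n * u₁)              ≡⟨ cong (b *_) nu₁≡au₂+r ⟩
  b * (a * u₂ + r)          ≡⟨ solve (a ∷ b ∷ u₂ ∷ r ∷ []) ⟩
  b * a * u₂ + b * r        ≡⟨ cong (λ x → x * u₂ + b * r) ba≡1+kn ⟩
  (1 + k * n) * u₂ + b * r  ≡⟨ solve (k ∷ n ∷ u₂ ∷ b ∷ r ∷ []) ⟩
  n * (k * u₂) + (b * r + u₂) ∎
  where open ≡-Reasoning

record VisibleInterior (c n u₁ u₂ : ℕ) : Set where
  field
    0<u₂        : 0 < u₂
    u₂<n        : u₂ < n
    c*u₂<n*u₁   : c * u₂ < n * u₁
    n*u₁<c*u₂+n : n * u₁ < c * u₂ + n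
    coprime     : gcd u₁ u₂ ≡ 1

visibleInteriorᵇ : ℕ → ℕ → ℕ × ℕ → Bool
visibleInteriorᵇ c n u = interiorᵇ c n u ∧ visibleᵇ u

box : ℕ → List (ℕ × ℕ)
box n = cartesianProduct (upTo (suc n)) (upTo (suc n))

latticePoints : ℕ → ℕ → List (ℕ × ℕ)
latticePoints c n = filterᵇ (visibleInteriorᵇ c n) (box n)

module _ {c n u₁ u₂ : ℕ} where

  T-visibleInteriorᵇ⁻ : T (visibleInteriorᵇ c n (u₁ , u₂)) → VisibleInterior c n u₁ u₂
  T-visibleInteriorᵇ⁻ t =
    let interior , visible = to T-∧ t
        p₁ , interior₂ = to T-∧ interior
        p₂ , interior₃ = to T-∧ interior₂
        p₃ , p₄ = to T-∧ interior₃
    in record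
      { 0<u₂ = <ᵇ⇒< 0 u₂ p₁ ; u₂<n = <ᵇ⇒< u₂ n p₂
      ; c*u₂<n*u₁ = <ᵇ⇒< _ _ p₃ ; n*u₁<c*u₂+n = <ᵇ⇒< _ _ p₄
      ; coprime = ≡ᵇ⇒≡ _ 1 visible }

  T-visibleInteriorᵇ⁺ : VisibleInterior c n u₁ u₂ → T (visibleInteriorᵇ c n (u₁ , u₂))
  T-visibleInteriorᵇ⁺ vi = from T-∧
    ( from T-∧ (<⇒<ᵇ 0<u₂ , from T-∧ (<⇒<ᵇ u₂<n , from T-∧ (<⇒<ᵇ c*u₂<n*u₁ , <⇒<ᵇ n*u₁<c*u₂+n)))
    , ≡⇒≡ᵇ _ 1 coprime )
    where open VisibleInterior vi

  visibleInterior⇒∈box : c ≤ n → VisibleInterior c n u₁ u₂ → (u₁ , u₂) ∈ box n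
  visibleInterior⇒∈box c≤n vi = ∈-cartesianProduct⁺ (∈-upTo⁺ u₁<1+n) (∈-upTo⁺ (m<n⇒m<1+n u₂<n))
    where
    open VisibleInterior vi
    open ≤-Reasoning
    u₁<1+n : u₁ < suc n
    u₁<1+n = *-cancelˡ-< n u₁ (suc n) (begin-strict
      n * u₁      <⟨ n*u₁<c*u₂+n ⟩
      c * u₂ + n  ≤⟨ +-monoˡ-≤ n (*-mono-≤ c≤n (<⇒≤ u₂<n)) ⟩
      n * n + n   ≡⟨ solve (n ∷ []) ⟩
      n * suc n   ∎)

  ∈-latticePoints⁻ : (u₁ , u₂) ∈ latticePoints c n → VisibleInterior c n u₁ u₂
  ∈-latticePoints⁻ u∈ = T-visibleInteriorᵇ⁻ (proj₂ (∈-filter⁻ (T? ∘ visibleInteriorᵇ c n) {xs = box n} u∈))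

  ∈-latticePoints⁺ : c ≤ n → VisibleInterior c n u₁ u₂ → (u₁ , u₂) ∈ latticePoints c n
  ∈-latticePoints⁺ c≤n vi =
    ∈-filter⁺ (T? ∘ visibleInteriorᵇ c n) (visibleInterior⇒∈box c≤n vi) (T-visibleInteriorᵇ⁺ vi)

latticePoints-unique : ∀ c n → Unique (latticePoints c n)
latticePoints-unique c n = Unique.filter⁺ (T? ∘ visibleInteriorᵇ c n)
  (Unique.cartesianProduct⁺ (Unique.upTo⁺ (suc n)) (Unique.upTo⁺ (suc n)))

module SwapLattice (a b k n : ℕ) .{{_ : NonZero n}} (ab≡1+kn : a * b ≡ 1 + k * n) where

  private
    ba≡1+kn : b * a ≡ 1 + k * n
    ba≡1+kn = trans (*-comm b a) ab≡1+kn

  module _ {u₁ u₂ : ℕ} (a*u₂≤n*u₁ : a * u₂ ≤ n * u₁) where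

    private
      r s : ℕ
      r = n * u₁ ∸ a * u₂
      s = b * u₁ ∸ k * u₂

      n*u₁≡a*u₂+r : n * u₁ ≡ a * u₂ + r
      n*u₁≡a*u₂+r = sym (m+[n∸m]≡n a*u₂≤n*u₁)

    n*s≡b*r+u₂ : n * s ≡ b * r + u₂
    n*s≡b*r+u₂ = begin
      n * (b * u₁ ∸ k * u₂)                       ≡⟨ *-distribˡ-∸ n (b * u₁) (k * u₂) ⟩
      n * (b * u₁) ∸ n * (k * u₂)                 ≡⟨ cong (_∸ n * (k * u₂)) n*[b*u₁]≡ ⟩
      n * (k * u₂) + (b * r + u₂) ∸ n * (k * u₂)  ≡⟨ m+n∸m≡n (n * (k * u₂)) _ ⟩
      b * r + u₂                                  ∎
      where
      open ≡-Reasoning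
      n*[b*u₁]≡ = n*[b*u₁]≡n*[k*u₂]+[b*r+u₂] a b k n u₁ u₂ r ba≡1+kn n*u₁≡a*u₂+r

    a*s≡k*r+u₁ : a * s ≡ k * r + u₁
    a*s≡k*r+u₁ = *-cancelˡ-≡ _ _ n (begin
      n * (a * s)             ≡⟨ n*[b*u₁]≡n*[k*u₂]+[b*r+u₂] b a k n s r u₂ ab≡1+kn n*s≡b*r+u₂ ⟩
      n * (k * r) + (a * u₂ + r) ≡⟨ cong (λ x → n * (k * r) + x) n*u₁≡a*u₂+r ⟨
      n * (k * r) + n * u₁    ≡⟨ *-distribˡ-+ n (k * r) u₁ ⟨
      n * (k * r + u₁)        ∎)
      where open ≡-Reasoning

    swapℕ²-inverseˡ : swapℕ² b a k n (swapℕ² a b k n (u₁ , u₂)) ≡ (u₁ , u₂)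
    swapℕ²-inverseˡ = cong₂ _,_
      (trans (cong (_∸ k * r) a*s≡k*r+u₁) (m+n∸m≡n (k * r) u₁))
      (trans (cong (_∸ b * r) n*s≡b*r+u₂) (m+n∸m≡n (b * r) u₂))

  swapℕ²-visibleInterior : ∀ {u₁ u₂} → VisibleInterior a n u₁ u₂ →
    VisibleInterior b n (b * u₁ ∸ k * u₂) (n * u₁ ∸ a * u₂)
  swapℕ²-visibleInterior {u₁} {u₂} vi = record
    { 0<u₂ = m<n⇒0<n∸m c*u₂<n*u₁
    ; u₂<n = +-cancelˡ-< (a * u₂) _ n (subst (_< a * u₂ + n) (sym (m+[n∸m]≡n a*u₂≤n*u₁)) n*u₁<c*u₂+n)
    ; c*u₂<n*u₁ = subst (b * r <_) (sym (n*s≡b*r+u₂ a*u₂≤n*u₁)) (m<m+n (b * r) 0<u₂)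
    ; n*u₁<c*u₂+n = subst (_< b * r + n) (sym (n*s≡b*r+u₂ a*u₂≤n*u₁)) (+-monoʳ-< (b * r) u₂<n)
    ; coprime = ∣1⇒≡1 (subst (d ∣_) coprime (gcd-greatest (proj₁ d∣u) (proj₂ d∣u)))
    }
    where
    open VisibleInterior vi
    a*u₂≤n*u₁ = <⇒≤ c*u₂<n*u₁
    r = n * u₁ ∸ a * u₂
    s = b * u₁ ∸ k * u₂
    d = gcd s r
    d∣u : d ∣² (u₁ , u₂)
    d∣u = subst (d ∣²_) (swapℕ²-inverseˡ a*u₂≤n*u₁)
      (∣²-swapℕ² b a k n (s , r) (gcd[m,n]∣m s r , gcd[m,n]∣n s r))

  V[a,n]≤V[b,n] : b ≤ n → V a n ≤ V b n
  V[a,n]≤V[b,n] b≤n = length-≤-injectiveOn (swapℕ² a b k n) (latticePoints-unique a n) maps inj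
    where
    maps : ∀ {u} → u ∈ latticePoints a n → swapℕ² a b k n u ∈ latticePoints b n
    maps {_ , _} u∈ = ∈-latticePoints⁺ b≤n (swapℕ²-visibleInterior (∈-latticePoints⁻ u∈))
    inverseˡ : ∀ {u} → u ∈ latticePoints a n → swapℕ² b a k n (swapℕ² a b k n u) ≡ u
    inverseˡ {_ , _} u∈ = swapℕ²-inverseˡ (<⇒≤ (VisibleInterior.c*u₂<n*u₁ (∈-latticePoints⁻ {a} {n} u∈)))
    inj : ∀ {u v} → u ∈ latticePoints a n → v ∈ latticePoints a n →
      swapℕ² a b k n u ≡ swapℕ² a b k n v → u ≡ v
    inj u∈ v∈ eq = trans (sym (inverseˡ u∈)) (trans (cong (swapℕ² b a k n) eq) (inverseˡ v∈))

ℕ-eq⇒ℤ-eq : ∀ m p q r → m * p ≡ 1 + q * r → + m ℤ.* + p ≡ 1ℤ ℤ.+ + q ℤ.* + r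
ℕ-eq⇒ℤ-eq m p q r eq = begin
  + m ℤ.* + p         ≡⟨ ℤ.pos-* m p ⟨
  + (m * p)           ≡⟨ cong +_ eq ⟩
  + (1 + q * r)       ≡⟨ ℤ.pos-+ 1 (q * r) ⟩
  1ℤ ℤ.+ + (q * r)    ≡⟨ cong (λ x → 1ℤ ℤ.+ x) (ℤ.pos-* q r) ⟩
  1ℤ ℤ.+ + q ℤ.* + r  ∎
  where open ≡-Reasoning

proposition3 : (a n b : ℕ) → 1 ≤ a → a < n → gcd a n ≡ 1 →
    1 ≤ b → b < n → n ∣ (a * b ∸ 1) →
    (Σ Mat₂ λ L → Unimodular L × MapsOnto L (InP a n) (InP b n))
    × (V a n ≡ V b n)
proposition3 a zero b _ () _ _ _ _
proposition3 a n@(suc _) b 1≤a a<n _ 1≤b b<n (divides k ab∸1≡kn) =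
  ( swapMat (+ a) (+ b) (+ k) (+ n)
  , swapMat-unimodular (+ a) (+ b) (+ k) (+ n) ba≡1+knℤ
  , swapMat-mapsOnto a b k n ba≡1+knℤ )
  , ≤-antisym (SwapLattice.V[a,n]≤V[b,n] a b k n ab≡1+kn (<⇒≤ b<n))
              (SwapLattice.V[a,n]≤V[b,n] b a k n ba≡1+kn (<⇒≤ a<n))
  where
  ab≡1+kn : a * b ≡ 1 + k * n
  ab≡1+kn = trans (sym (m+[n∸m]≡n (*-mono-≤ 1≤a 1≤b))) (cong (λ x → 1 + x) ab∸1≡kn)
  ba≡1+kn : b * a ≡ 1 + k * n
  ba≡1+kn = trans (*-comm b a) ab≡1+kn
  ba≡1+knℤ : + b ℤ.* + a ≡ 1ℤ ℤ.+ + k ℤ.* + n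
  ba≡1+knℤ = ℕ-eq⇒ℤ-eq b a k n ba≡1+kn
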